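{- Let $n\ge 1$ and let $\mathcal{C}$ be the caterpillar tree consisting of the path $0,1,\dots,n$ (edges $\{t,t+1\}$) together with, for each $1\le t\le n-1$, $i_t\ge 0$ pendant vertices attached to vertex $t$, labelled $n+1,\dots,n+s$ with $s=\sum_{t=1}^{n-1}i_t$ so that those attached to $1$ come first, then those attached to $2$, and so on. For $1\le c\le s$ let $a(c)$ be the path vertex adjacent to $n+c$. Let $M$ be the $(2n-1)\times s$ matrix with $M_{m,c}=\max\{m,a(c)\}+1$ for $1\le m\le n$ and $M_{m,c}=n+1$ for $n+1\le m\le 2n-1$ (equivalently, the matrix of Steiner distances $d_{\mathcal{C}}(X_1\cup X_2)$ with rows $X_1$ running over $\{0,1\},\dots,\{0,n\},\{1,n\},\dots,\{n-1,n\}$ and columns $X_2$ over $\{0,n+1\},\dots,\{0,n+s\}$). Let $L$ be the Laplacian matrix of the path on $2n-1$ vertices $1,\dots,2n-1$. Then for all $1\le r,m\le s$, \[(M'LM)_{r,m}=n-\max\{a(r),a(m)\}.\] Equivalently, if $a(m)=k$, the $m$-th column of $M'LM$ is $(n-k,\dots,n-k,\underbrace{n-k-1,\dots,n-k-1}_{i_{k+1}},\dots,\underbrace{1,\dots,1}_{i_{n-1}})'$, where the first block consists of the $i_1+\dots+i_k$ entries indexed by pendant vertices attached to $1,\dots,k$.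
   Context: For a connected graph $G$ and a vertex set $Y$ with $|Y|\ge 2$, the Steiner distance $d_G(Y)$ is the minimum number of edges among all connected subgraphs of $G$ whose vertex set contains $Y$. The Laplacian of a graph has diagonal entries equal to vertex degrees, $-1$ at $(i,j)$ if $i,j$ are adjacent, and $0$ otherwise. $M'$ denotes the transpose. -}

module Defs where

open import Data.Nat as ℕ using (ℕ; zero; suc; _≤_; _≤?_; _⊔_; _≟_)
open import Data.Integer as ℤ using (ℤ; +_; -_)
open import Data.Fin using (Fin; toℕ)
open import Data.Fin as F using ()
open import Data.List using (List; []; _∷_; _++_; replicate; length; lookup; concatMap)
open import Relation.Nullary using (yes; no)

rangeFrom : ℕ → ℕ → List ℕ
rangeFrom a zero = []
rangeFrom a (suc k) = a ∷ rangeFrom (suc a) k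

innerPath : ℕ → List ℕ
innerPath n = rangeFrom 1 (n ℕ.∸ 1)

-- attachment list: pendant vertex n+c (c = 1..s) is entry c-1; its value is a(c).
-- Pendants attached to 1 come first, then those attached to 2, etc.
attachList : (n : ℕ) → (i : ℕ → ℕ) → List ℕ
attachList n i = concatMap (λ t → replicate (i t) t) (innerPath n)

numPendants : (n : ℕ) → (i : ℕ → ℕ) → ℕ
numPendants n i = length (attachList n i)

attach : (n : ℕ) → (i : ℕ → ℕ) → Fin (numPendants n i) → ℕ
attach n i c = lookup (attachList n i) c

sumFin : (k : ℕ) → (Fin k → ℤ) → ℤ
sumFin zero f = + 0
sumFin (suc k) f = f F.zero ℤ.+ sumFin k (λ j → f (F.suc j))

Matrix : ℕ → ℕ → Set
Matrix r c = Fin r → Fin c → ℤ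

transpose : ∀ {r c} → Matrix r c → Matrix c r
transpose A i j = A j i

_⊗_ : ∀ {r k c} → Matrix r k → Matrix k c → Matrix r c
_⊗_ {k = k} A B i j = sumFin k (λ l → A i l ℤ.* B l j)

-- adjacency matrix of the path on N vertices 1,…,N (0-based index p ↦ vertex p+1)
pathAdj : (N : ℕ) → Matrix N N
pathAdj N p q with suc (toℕ p) ≟ toℕ q | suc (toℕ q) ≟ toℕ p
... | yes _ | _ = + 1
... | no _ | yes _ = + 1
... | no _ | no _ = + 0

laplacian : (N : ℕ) → Matrix N N → Matrix N N
laplacian N A p q with toℕ p ≟ toℕ q
... | yes _ = sumFin N (λ r → A p r)
... | no _ = - (A p q)

pathLaplacian : (N : ℕ) → Matrix N N
pathLaplacian N = laplacian N (pathAdj N)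

-- M : (2n-1) × s, row index m = 1..2n-1 (0-based p = m-1), column c = 1..s
Mmat : (n : ℕ) → (i : ℕ → ℕ) → Matrix (2 ℕ.* n ℕ.∸ 1) (numPendants n i)
Mmat n i p c with suc (toℕ p) ≤? n
... | yes _ = + (suc (toℕ p) ⊔ attach n i c) ℤ.+ + 1
... | no _ = + (n ℕ.+ 1)

{-# OPTIONS --safe #-}

-- The path Laplacian factors as L = ∇ᵀ∇, where ∇ takes differences along the edges
-- {x, x+1}. As a function of the row m, the column of M belonging to a pendant at a is
-- 1 + min(max(a, m), n): its differences are the indicator of the edges between rows a
-- and n, so ∇ᵀ∇ of the column is the difference of the unit vectors at rows n and a.
-- Hence (M'LM)_{r,m} = M_{n,r} - M_{a(m),r} = (n + 1) - (max(a(r), a(m)) + 1).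

module Submission where

open import Defs

module PathLaplacian where

  import Algebra.Properties.Semiring.Sum
  open import Data.Fin using (Fin; toℕ)
  import Data.Fin as F
  open import Data.Empty using (⊥-elim)
  open import Data.Fin.Properties using (toℕ-injective; toℕ<n)
  open import Data.Integer using (ℤ; +_; -_; _+_; _-_; _*_; 0ℤ; 1ℤ; _⊖_)
  import Data.Integer.Properties as ℤP
  open import Data.Integer.Tactic.RingSolver using (solve-∀)
  open import Data.List.Membership.Propositional.Properties using (∈-lookup)
  open import Data.List.Relation.Unary.All as All using (All; []; _∷_)
  open import Data.List.Relation.Unary.All.Properties using (concat⁺; map⁺; replicate⁺)
  open import Data.Product using (_×_; _,_; proj₁; proj₂; map₂)
  open import Data.Nat as ℕ using (ℕ; zero; suc; _≤_; _<_; _⊔_; _⊓_; _∸_; _≟_; _≤?_; z≤n; s≤s)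
  import Data.Nat.Properties as ℕP
  open import Function using (_∘_)
  open import Relation.Binary.PropositionalEquality
    using (_≡_; _≢_; refl; sym; trans; cong; cong₂; subst; module ≡-Reasoning)
  open import Relation.Nullary using (yes; no)

  open Algebra.Properties.Semiring.Sum ℤP.+-*-semiring
    using (sum; sum-cong-≗; ∑-distrib-+; *-distribʳ-sum; sum-replicate-zero)
  open ≡-Reasoning

  sumFin≡sum : ∀ k (f : Fin k → ℤ) → sumFin k f ≡ sum f
  sumFin≡sum zero    f = refl
  sumFin≡sum (suc k) f = cong (_+_ (f F.zero)) (sumFin≡sum k (f ∘ F.suc))

  sumBelow : ℕ → (ℕ → ℤ) → ℤ
  sumBelow N f = sum {N} (f ∘ toℕ)

  sumBelow-cong : ∀ N {f g : ℕ → ℤ} → (∀ y → f y ≡ g y) → sumBelow N f ≡ sumBelow N g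
  sumBelow-cong N f≗g = sum-cong-≗ {N} (f≗g ∘ toℕ)

  sumFin-toℕ : ∀ N {f : Fin N → ℤ} (g : ℕ → ℤ) → (∀ p → f p ≡ g (toℕ p)) →
    sumFin N f ≡ sumBelow N g
  sumFin-toℕ N {f} g f≗g = trans (sumFin≡sum N f) (sum-cong-≗ {N} f≗g)

  sumBelow-zero : ∀ N {f : ℕ → ℤ} → (∀ y → f y ≡ 0ℤ) → sumBelow N f ≡ 0ℤ
  sumBelow-zero N f≗0 = trans (sumBelow-cong N {g = λ _ → 0ℤ} f≗0) (sum-replicate-zero N)

  sumBelow-distrib-+ : ∀ N (f g : ℕ → ℤ) →
    sumBelow N (λ y → f y + g y) ≡ sumBelow N f + sumBelow N g
  sumBelow-distrib-+ N f g = ∑-distrib-+ {N} (f ∘ toℕ) (g ∘ toℕ)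

  sumBelow-distrib-- : ∀ N (f g : ℕ → ℤ) →
    sumBelow N (λ y → f y - g y) ≡ sumBelow N f - sumBelow N g
  sumBelow-distrib-- zero    f g = refl
  sumBelow-distrib-- (suc N) f g =
    trans (cong (_+_ (f 0 - g 0)) (sumBelow-distrib-- N (f ∘ suc) (g ∘ suc)))
          (interchange (f 0) (g 0) (sumBelow N (f ∘ suc)) (sumBelow N (g ∘ suc)))
    where
    interchange : ∀ a b c d → a - b + (c - d) ≡ a + c - (b + d)
    interchange = solve-∀

  δ : ℕ → ℕ → ℤ
  δ zero    zero    = 1ℤ
  δ zero    (suc _) = 0ℤ
  δ (suc _) zero    = 0ℤ
  δ (suc x) (suc y) = δ x y

  δ-≡ : ∀ {x y} → x ≡ y → δ x y ≡ 1ℤ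
  δ-≡ {zero}  refl = refl
  δ-≡ {suc x} refl = δ-≡ {x} refl

  δ-≢ : ∀ {x y} → x ≢ y → δ x y ≡ 0ℤ
  δ-≢ {zero}  {zero}  x≢y = ⊥-elim (x≢y refl)
  δ-≢ {zero}  {suc y} _   = refl
  δ-≢ {suc x} {zero}  _   = refl
  δ-≢ {suc x} {suc y} x≢y = δ-≢ (x≢y ∘ cong suc)

  [_<_] : ℕ → ℕ → ℤ
  [ _     < zero  ] = 0ℤ
  [ zero  < suc _ ] = 1ℤ
  [ suc x < suc n ] = [ x < n ]

  [<]-true : ∀ {x n} → x < n → [ x < n ] ≡ 1ℤ
  [<]-true {zero}  {suc n} _          = refl
  [<]-true {suc x} {suc n} (s≤s x<n) = [<]-true x<n

  [<]-absorb : ∀ y {n N} → n ≤ N → [ y < N ] * [ y < n ] ≡ [ y < n ]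
  [<]-absorb y       {zero}  {N}     _         = ℤP.*-zeroʳ [ y < N ]
  [<]-absorb zero    {suc n} {suc N} _         = refl
  [<]-absorb (suc y) {suc n} {suc N} (s≤s n≤N) = [<]-absorb y n≤N

  [<]-step : ∀ y n → [ y < n ] - [ suc y < n ] ≡ δ n (suc y)
  [<]-step y       zero          = refl
  [<]-step zero    (suc zero)    = refl
  [<]-step zero    (suc (suc n)) = refl
  [<]-step (suc y) (suc n)       = [<]-step y n

  sumBelow-δ : ∀ N x (w : ℕ → ℤ) → sumBelow N (λ y → δ x y * w y) ≡ [ x < N ] * w x
  sumBelow-δ zero    x       w = sym (ℤP.*-zeroˡ (w x))
  sumBelow-δ (suc N) zero    w =
    trans (cong (_+_ (1ℤ * w 0)) (sumBelow-zero N (λ y → ℤP.*-zeroˡ (w (suc y)))))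
          (ℤP.+-identityʳ _)
  sumBelow-δ (suc N) (suc x) w =
    trans (cong₂ _+_ (ℤP.*-zeroˡ (w 0)) (sumBelow-δ N x (w ∘ suc))) (ℤP.+-identityˡ _)

  sumBelow-δ-< : ∀ N {x} (w : ℕ → ℤ) → x < N → sumBelow N (λ y → δ x y * w y) ≡ w x
  sumBelow-δ-< N {x} w x<N = begin
    sumBelow N (λ y → δ x y * w y) ≡⟨ sumBelow-δ N x w ⟩
    [ x < N ] * w x                ≡⟨ cong (_* w x) ([<]-true x<N) ⟩
    1ℤ * w x                       ≡⟨ ℤP.*-identityˡ (w x) ⟩
    w x                            ∎

  laplacian-entry : ∀ {N} (A : Matrix N N) → (∀ p → A p p ≡ 0ℤ) → ∀ p q →
    laplacian N A p q ≡ δ (toℕ p) (toℕ q) * sumFin N (A p) - A p q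
  laplacian-entry {N} A hollow p q with toℕ p ≟ toℕ q
  ... | yes p≡q = sym (begin
    δ (toℕ p) (toℕ q) * sumFin N (A p) - A p q
      ≡⟨ cong₂ (λ d a → d * sumFin N (A p) - a) (δ-≡ p≡q) Apq≡0 ⟩
    1ℤ * sumFin N (A p) - 0ℤ
      ≡⟨ trans (ℤP.+-identityʳ _) (ℤP.*-identityˡ _) ⟩
    sumFin N (A p) ∎)
    where
    Apq≡0 : A p q ≡ 0ℤ
    Apq≡0 = trans (cong (A p) (sym (toℕ-injective p≡q))) (hollow p)
  ... | no p≢q = sym (begin
    δ (toℕ p) (toℕ q) * sumFin N (A p) - A p q
      ≡⟨ cong (λ d → d * sumFin N (A p) - A p q) (δ-≢ p≢q) ⟩
    0ℤ * sumFin N (A p) - A p q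
      ≡⟨ cong (_- A p q) (ℤP.*-zeroˡ (sumFin N (A p))) ⟩
    0ℤ - A p q
      ≡⟨ ℤP.+-identityˡ _ ⟩
    - A p q ∎)

  laplacian-row : ∀ N x (e v : ℕ → ℤ) → x < N →
    sumBelow N (λ y → (δ x y * sumBelow N e - e y) * v y)
      ≡ sumBelow N (λ y → e y * (v x - v y))
  laplacian-row N x e v x<N = begin
    sumBelow N (λ y → (δ x y * D - e y) * v y)
      ≡⟨ sumBelow-cong N (λ y → expand (δ x y) D (e y) (v y)) ⟩
    sumBelow N (λ y → δ x y * (D * v y) - e y * v y)
      ≡⟨ sumBelow-distrib-- N (λ y → δ x y * (D * v y)) (λ y → e y * v y) ⟩
    sumBelow N (λ y → δ x y * (D * v y)) - sumBelow N (λ y → e y * v y)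
      ≡⟨ cong (_- sumBelow N (λ y → e y * v y)) (sumBelow-δ-< N (λ y → D * v y) x<N) ⟩
    D * v x - sumBelow N (λ y → e y * v y)
      ≡⟨ cong (_- sumBelow N (λ y → e y * v y)) (*-distribʳ-sum {N} (v x) (e ∘ toℕ)) ⟩
    sumBelow N (λ y → e y * v x) - sumBelow N (λ y → e y * v y)
      ≡⟨ sumBelow-distrib-- N (λ y → e y * v x) (λ y → e y * v y) ⟨
    sumBelow N (λ y → e y * v x - e y * v y)
      ≡⟨ sumBelow-cong N (λ y → factor (e y) (v x) (v y)) ⟩
    sumBelow N (λ y → e y * (v x - v y)) ∎
    where
    D = sumBelow N e
    expand : ∀ d s a b → (d * s - a) * b ≡ d * (s * b) - a * b
    expand = solve-∀
    factor : ∀ a b c → a * b - a * c ≡ a * (b - c)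
    factor = solve-∀

  pathEdge : ℕ → ℕ → ℤ
  pathEdge x y = δ (suc x) y + δ x (suc y)

  pathAdj≡pathEdge : ∀ {N} (p q : Fin N) → pathAdj N p q ≡ pathEdge (toℕ p) (toℕ q)
  pathAdj≡pathEdge p q with suc (toℕ p) ≟ toℕ q | suc (toℕ q) ≟ toℕ p
  ... | yes 1+p≡q | _        =
    sym (cong₂ _+_ (δ-≡ 1+p≡q) (δ-≢ (ℕP.<⇒≢ (ℕP.m<n⇒m<1+n (ℕP.≤-reflexive 1+p≡q)))))
  ... | no 1+p≢q  | yes 1+q≡p = sym (cong₂ _+_ (δ-≢ 1+p≢q) (δ-≡ (sym 1+q≡p)))
  ... | no 1+p≢q  | no 1+q≢p  = sym (cong₂ _+_ (δ-≢ 1+p≢q) (δ-≢ (1+q≢p ∘ sym)))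

  pathAdj-hollow : ∀ {N} (p : Fin N) → pathAdj N p p ≡ 0ℤ
  pathAdj-hollow p = trans (pathAdj≡pathEdge p p)
    (cong₂ _+_ (δ-≢ (ℕP.<⇒≢ (ℕP.n<1+n (toℕ p)) ∘ sym)) (δ-≢ (ℕP.<⇒≢ (ℕP.n<1+n (toℕ p)))))

  pathLaplacian-entry : ∀ {N} (p q : Fin N) →
    pathLaplacian N p q
      ≡ δ (toℕ p) (toℕ q) * sumBelow N (pathEdge (toℕ p)) - pathEdge (toℕ p) (toℕ q)
  pathLaplacian-entry {N} p q = begin
    pathLaplacian N p q
      ≡⟨ laplacian-entry (pathAdj N) pathAdj-hollow p q ⟩
    δ (toℕ p) (toℕ q) * sumFin N (pathAdj N p) - pathAdj N p q
      ≡⟨ cong₂ (λ d a → δ (toℕ p) (toℕ q) * d - a) degree (pathAdj≡pathEdge p q) ⟩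
    δ (toℕ p) (toℕ q) * sumBelow N (pathEdge (toℕ p)) - pathEdge (toℕ p) (toℕ q) ∎
    where
    degree : sumFin N (pathAdj N p) ≡ sumBelow N (pathEdge (toℕ p))
    degree = sumFin-toℕ N (pathEdge (toℕ p)) (pathAdj≡pathEdge p)

  ∇ : ℕ → (ℕ → ℤ) → ℕ → ℤ
  ∇ N v x = [ suc x < N ] * (v (suc x) - v x)

  -- No cut-off at the far end is needed: ∇ N already vanishes beyond the last edge.
  ∇ᵀ : (ℕ → ℤ) → ℕ → ℤ
  ∇ᵀ f zero    = - f zero
  ∇ᵀ f (suc x) = f x - f (suc x)

  sumBelow-pathEdge : ∀ N x (w : ℕ → ℤ) →
    sumBelow N (λ y → pathEdge x y * w y)
      ≡ [ suc x < N ] * w (suc x) + sumBelow N (λ y → δ x (suc y) * w y)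
  sumBelow-pathEdge N x w = begin
    sumBelow N (λ y → pathEdge x y * w y)
      ≡⟨ sumBelow-cong N (λ y → ℤP.*-distribʳ-+ (w y) (δ (suc x) y) (δ x (suc y))) ⟩
    sumBelow N (λ y → δ (suc x) y * w y + δ x (suc y) * w y)
      ≡⟨ sumBelow-distrib-+ N (λ y → δ (suc x) y * w y) (λ y → δ x (suc y) * w y) ⟩
    sumBelow N (λ y → δ (suc x) y * w y) + sumBelow N (λ y → δ x (suc y) * w y)
      ≡⟨ cong (_+ sumBelow N (λ y → δ x (suc y) * w y)) (sumBelow-δ N (suc x) w) ⟩
    [ suc x < N ] * w (suc x) + sumBelow N (λ y → δ x (suc y) * w y) ∎

  pathEdge-row : ∀ N x (v : ℕ → ℤ) → x < N →
    sumBelow N (λ y → pathEdge x y * (v x - v y)) ≡ ∇ᵀ (∇ N v) x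
  pathEdge-row N zero v _ = begin
    sumBelow N (λ y → pathEdge 0 y * (v 0 - v y))
      ≡⟨ sumBelow-pathEdge N 0 (λ y → v 0 - v y) ⟩
    [ 1 < N ] * (v 0 - v 1) + sumBelow N (λ y → 0ℤ * (v 0 - v y))
      ≡⟨ cong (_+_ ([ 1 < N ] * (v 0 - v 1))) (sumBelow-zero N (λ y → ℤP.*-zeroˡ (v 0 - v y))) ⟩
    [ 1 < N ] * (v 0 - v 1) + 0ℤ
      ≡⟨ swap-sign ([ 1 < N ]) (v 0) (v 1) ⟩
    - ([ 1 < N ] * (v 1 - v 0)) ∎
    where
    swap-sign : ∀ i a b → i * (a - b) + 0ℤ ≡ - (i * (b - a))
    swap-sign = solve-∀
  pathEdge-row N (suc x) v 1+x<N = begin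
    sumBelow N (λ y → pathEdge (suc x) y * (v (suc x) - v y))
      ≡⟨ sumBelow-pathEdge N (suc x) (λ y → v (suc x) - v y) ⟩
    i * (v (suc x) - v (suc (suc x))) + sumBelow N (λ y → δ x y * (v (suc x) - v y))
      ≡⟨ cong (_+_ (i * (v (suc x) - v (suc (suc x)))))
              (sumBelow-δ-< N (λ y → v (suc x) - v y) (ℕP.<-trans (ℕP.n<1+n x) 1+x<N)) ⟩
    i * (v (suc x) - v (suc (suc x))) + (v (suc x) - v x)
      ≡⟨ regroup i (v x) (v (suc x)) (v (suc (suc x))) ⟩
    1ℤ * (v (suc x) - v x) - i * (v (suc (suc x)) - v (suc x))
      ≡⟨ cong (λ j → j * (v (suc x) - v x) - i * (v (suc (suc x)) - v (suc x))) ([<]-true 1+x<N) ⟨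
    ∇ᵀ (∇ N v) (suc x) ∎
    where
    i = [ suc (suc x) < N ]
    regroup : ∀ i a b c → i * (b - c) + (b - a) ≡ 1ℤ * (b - a) - i * (c - b)
    regroup = solve-∀

  pathLaplacian-factorises : ∀ N (p : Fin N) {u : Fin N → ℤ} (v : ℕ → ℤ) →
    (∀ q → u q ≡ v (toℕ q)) →
    sumFin N (λ q → pathLaplacian N p q * u q) ≡ ∇ᵀ (∇ N v) (toℕ p)
  pathLaplacian-factorises N p {u} v u≗v = begin
    sumFin N (λ q → pathLaplacian N p q * u q)
      ≡⟨ sumFin-toℕ N (λ y → (δ x y * sumBelow N (pathEdge x) - pathEdge x y) * v y)
                     (λ q → cong₂ _*_ (pathLaplacian-entry p q) (u≗v q)) ⟩
    sumBelow N (λ y → (δ x y * sumBelow N (pathEdge x) - pathEdge x y) * v y)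
      ≡⟨ laplacian-row N x (pathEdge x) v (toℕ<n p) ⟩
    sumBelow N (λ y → pathEdge x y * (v x - v y))
      ≡⟨ pathEdge-row N x v (toℕ<n p) ⟩
    ∇ᵀ (∇ N v) x ∎
    where
    x = toℕ p

  ∇ᵀ-shift : ∀ (f g : ℕ → ℤ) → g 0 ≡ 0ℤ → (∀ x → f x ≡ g (suc x)) →
    ∀ x → ∇ᵀ f x ≡ g x - g (suc x)
  ∇ᵀ-shift f g g0≡0 f≗g∘suc zero = begin
    - f 0          ≡⟨ cong -_ (f≗g∘suc 0) ⟩
    - g 1          ≡⟨ ℤP.+-identityˡ (- g 1) ⟨
    0ℤ - g 1       ≡⟨ cong (_- g 1) g0≡0 ⟨
    g 0 - g 1      ∎
  ∇ᵀ-shift f g _ f≗g∘suc (suc x) = cong₂ _-_ (f≗g∘suc x) (f≗g∘suc (suc x))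

  +[1+m]-+[1+n]≡+m-+n : ∀ m n → + suc m - + suc n ≡ + m - + n
  +[1+m]-+[1+n]≡+m-+n m n = begin
    + suc m - + suc n ≡⟨ ℤP.m-n≡m⊖n (suc m) (suc n) ⟩
    suc m ⊖ suc n     ≡⟨ ℤP.[1+m]⊖[1+n]≡m⊖n m n ⟩
    m ⊖ n             ≡⟨ ℤP.m-n≡m⊖n m n ⟨
    + m - + n         ∎

  [i+1]-[j+1]≡i-j : ∀ i j → i + 1ℤ - (j + 1ℤ) ≡ i - j
  [i+1]-[j+1]≡i-j = solve-∀

  clamp : ℕ → ℕ → ℕ → ℕ
  clamp b n y = (b ⊔ y) ⊓ n

  clamp-step : ∀ y {b n} → b ≤ n → + clamp b n (suc y) - + clamp b n y ≡ [ y < n ] - [ y < b ]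
  clamp-step zero    {zero}  {zero}  _ = refl
  clamp-step zero    {zero}  {suc n} _ = refl
  clamp-step (suc y) {zero}  {zero}  _ = refl
  clamp-step (suc y) {zero}  {suc n} _ =
    trans (+[1+m]-+[1+n]≡+m-+n (suc y ⊓ n) (y ⊓ n)) (clamp-step y z≤n)
  clamp-step zero    {suc b} {suc n} _ rewrite ℕP.⊔-identityʳ b = ℤP.+-inverseʳ (+ suc (b ⊓ n))
  clamp-step (suc y) {suc b} {suc n} (s≤s b≤n) =
    trans (+[1+m]-+[1+n]≡+m-+n (clamp b n (suc y)) (clamp b n y)) (clamp-step y b≤n)

  column : ℕ → ℕ → ℕ → ℤ
  column n b x = + clamp b n (suc x) + 1ℤ

  ∇-column : ∀ N n b x → b ≤ n → n ≤ N → ∇ N (column n b) x ≡ [ suc x < n ] - [ suc x < b ]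
  ∇-column N n b x b≤n n≤N = begin
    [ suc x < N ] * (column n b (suc x) - column n b x)
      ≡⟨ cong (_*_ [ suc x < N ]) ([i+1]-[j+1]≡i-j (+ clamp b n (suc (suc x))) (+ clamp b n (suc x))) ⟩
    [ suc x < N ] * (+ clamp b n (suc (suc x)) - + clamp b n (suc x))
      ≡⟨ cong (_*_ [ suc x < N ]) (clamp-step (suc x) b≤n) ⟩
    [ suc x < N ] * ([ suc x < n ] - [ suc x < b ])
      ≡⟨ distrib [ suc x < N ] [ suc x < n ] [ suc x < b ] ⟩
    [ suc x < N ] * [ suc x < n ] - [ suc x < N ] * [ suc x < b ]
      ≡⟨ cong₂ _-_ ([<]-absorb (suc x) n≤N) ([<]-absorb (suc x) (ℕP.≤-trans b≤n n≤N)) ⟩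
    [ suc x < n ] - [ suc x < b ] ∎
    where
    distrib : ∀ i a b → i * (a - b) ≡ i * a - i * b
    distrib = solve-∀

  ∇ᵀ∇-column : ∀ N n b x → 1 ≤ b → b ≤ n → n ≤ N →
    ∇ᵀ (∇ N (column n b)) x ≡ δ n (suc x) - δ b (suc x)
  ∇ᵀ∇-column N (suc n) (suc b) x _ b≤n n≤N = begin
    ∇ᵀ (∇ N (column (suc n) (suc b))) x
      ≡⟨ ∇ᵀ-shift _ χ refl (λ y → ∇-column N (suc n) (suc b) y b≤n n≤N) x ⟩
    χ x - χ (suc x)
      ≡⟨ regroup [ x < suc n ] [ suc x < suc n ] [ x < suc b ] [ suc x < suc b ] ⟩
    ([ x < suc n ] - [ suc x < suc n ]) - ([ x < suc b ] - [ suc x < suc b ])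
      ≡⟨ cong₂ _-_ ([<]-step x (suc n)) ([<]-step x (suc b)) ⟩
    δ (suc n) (suc x) - δ (suc b) (suc x) ∎
    where
    χ : ℕ → ℤ
    χ y = [ y < suc n ] - [ y < suc b ]
    regroup : ∀ a b c d → (a - c) - (b - d) ≡ (a - b) - (c - d)
    regroup = solve-∀

  column-value : ∀ {n a x} → a ⊔ suc x ≤ n → column n a x ≡ + (a ⊔ suc x) + 1ℤ
  column-value a⊔x<n = cong (λ k → + k + 1ℤ) (ℕP.m≤n⇒m⊓n≡m a⊔x<n)

  sumBelow-column-δ : ∀ N n a b → 1 ≤ b → a ≤ n → b ≤ n → n ≤ N →
    sumBelow N (λ x → column n a x * (δ n (suc x) - δ b (suc x))) ≡ + (n ∸ (a ⊔ b))
  sumBelow-column-δ N (suc n) a (suc b) _ a≤n b≤n n<N = begin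
    sumBelow N (λ x → u x * (δ n x - δ b x))
      ≡⟨ sumBelow-cong N (λ x → distrib (u x) (δ n x) (δ b x)) ⟩
    sumBelow N (λ x → δ n x * u x - δ b x * u x)
      ≡⟨ sumBelow-distrib-- N (λ x → δ n x * u x) (λ x → δ b x * u x) ⟩
    sumBelow N (λ x → δ n x * u x) - sumBelow N (λ x → δ b x * u x)
      ≡⟨ cong₂ _-_ (sumBelow-δ-< N u n<N) (sumBelow-δ-< N u (ℕP.≤-trans b≤n n<N)) ⟩
    u n - u b
      ≡⟨ cong₂ _-_ (column-value (ℕP.⊔-lub a≤n ℕP.≤-refl)) (column-value (ℕP.⊔-lub a≤n b≤n)) ⟩
    + (a ⊔ suc n) + 1ℤ - (+ (a ⊔ suc b) + 1ℤ)
      ≡⟨ [i+1]-[j+1]≡i-j (+ (a ⊔ suc n)) (+ (a ⊔ suc b)) ⟩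
    + (a ⊔ suc n) - + (a ⊔ suc b)
      ≡⟨ cong (λ k → + k - + (a ⊔ suc b)) (ℕP.m≤n⇒m⊔n≡n a≤n) ⟩
    + suc n - + (a ⊔ suc b)
      ≡⟨ ℤP.m-n≡m⊖n (suc n) (a ⊔ suc b) ⟩
    suc n ⊖ (a ⊔ suc b)
      ≡⟨ ℤP.⊖-≥ (ℕP.⊔-lub a≤n b≤n) ⟩
    + (suc n ∸ (a ⊔ suc b)) ∎
    where
    u = column (suc n) a
    distrib : ∀ u d e → u * (d - e) ≡ d * u - e * u
    distrib = solve-∀

  rangeFrom-bounds : ∀ a k → All (λ v → a ≤ v × v < a ℕ.+ k) (rangeFrom a k)
  rangeFrom-bounds a zero    = []
  rangeFrom-bounds a (suc k) =
    (ℕP.≤-refl , ℕP.m<m+n a (s≤s z≤n))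
      ∷ All.map (λ {v} (a<v , v<1+a+k) → ℕP.<⇒≤ a<v , subst (v <_) (sym (ℕP.+-suc a k)) v<1+a+k)
                (rangeFrom-bounds (suc a) k)

  attach-bounds : ∀ n i c → 1 ≤ attach n i c × attach n i c ≤ n ∸ 1
  attach-bounds n i c = map₂ ℕP.≤-pred (All.lookup attachList-bounds (∈-lookup c))
    where
    attachList-bounds : All (λ v → 1 ≤ v × v < suc (n ∸ 1)) (attachList n i)
    attachList-bounds =
      concat⁺ (map⁺ (All.map (λ {t} → replicate⁺ (i t)) (rangeFrom-bounds 1 (n ∸ 1))))

  attach-≤ : ∀ n i c → attach n i c ≤ n
  attach-≤ n i c = ℕP.≤-trans (proj₂ (attach-bounds n i c)) (ℕP.m∸n≤m n 1)

  n≤2n∸1 : ∀ {n} → 1 ≤ n → n ≤ 2 ℕ.* n ∸ 1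
  n≤2n∸1 {suc m} _ = ℕP.≤-trans (s≤s (ℕP.m≤m+n m 0)) (ℕP.m≤n+m (suc (m ℕ.+ 0)) m)

  Mmat≡column : ∀ n i p c → Mmat n i p c ≡ column n (attach n i c) (toℕ p)
  Mmat≡column n i p c with suc (toℕ p) ≤? n
  ... | yes 1+p≤n = cong (λ k → + k + 1ℤ)
    (trans (ℕP.⊔-comm (suc (toℕ p)) a) (sym (ℕP.m≤n⇒m⊓n≡m (ℕP.⊔-lub (attach-≤ n i c) 1+p≤n))))
    where a = attach n i c
  ... | no 1+p≰n = trans (ℤP.pos-+ n 1) (cong (λ k → + k + 1ℤ) (sym (ℕP.m≥n⇒m⊓n≡n
    (ℕP.≤-trans (ℕP.<⇒≤ (ℕP.≰⇒> 1+p≰n)) (ℕP.m≤n⊔m (attach n i c) (suc (toℕ p)))))))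

  pathLaplacian⊗Mmat : ∀ n i → 1 ≤ n → ∀ p c →
    (pathLaplacian (2 ℕ.* n ∸ 1) ⊗ Mmat n i) p c
      ≡ δ n (suc (toℕ p)) - δ (attach n i c) (suc (toℕ p))
  pathLaplacian⊗Mmat n i 1≤n p c = begin
    (pathLaplacian N ⊗ Mmat n i) p c
      ≡⟨ pathLaplacian-factorises N p (column n b) (λ q → Mmat≡column n i q c) ⟩
    ∇ᵀ (∇ N (column n b)) (toℕ p)
      ≡⟨ ∇ᵀ∇-column N n b (toℕ p)
           (proj₁ (attach-bounds n i c)) (attach-≤ n i c) (n≤2n∸1 1≤n) ⟩
    δ n (suc (toℕ p)) - δ b (suc (toℕ p)) ∎
    where
    N = 2 ℕ.* n ∸ 1
    b = attach n i c

open PathLaplacian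

open import Data.Nat using (ℕ; _≤_; _∸_; _⊔_; _*_)
open import Data.Integer using (+_)
open import Data.Fin using (Fin)
open import Relation.Binary.PropositionalEquality using (_≡_)

open import Data.Integer as ℤ using ()
open import Data.Nat using (suc)
open import Data.Product using (proj₁)
open import Relation.Binary.PropositionalEquality using (cong₂; module ≡-Reasoning)
open ≡-Reasoning

mainTheorem5 : (n : ℕ) → 1 ≤ n → (i : ℕ → ℕ) →
    (r m : Fin (numPendants n i)) →
    (transpose (Mmat n i) ⊗ (pathLaplacian (2 * n ∸ 1) ⊗ Mmat n i)) r m
    ≡ + (n ∸ (attach n i r ⊔ attach n i m))
mainTheorem5 n 1≤n i r m = begin
  (transpose (Mmat n i) ⊗ (pathLaplacian N ⊗ Mmat n i)) r m
    ≡⟨ sumFin-toℕ N (λ x → column n a x ℤ.* (δ n (suc x) ℤ.- δ b (suc x)))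
                   (λ p → cong₂ ℤ._*_ (Mmat≡column n i p r) (pathLaplacian⊗Mmat n i 1≤n p m)) ⟩
  sumBelow N (λ x → column n a x ℤ.* (δ n (suc x) ℤ.- δ b (suc x)))
    ≡⟨ sumBelow-column-δ N n a b
         (proj₁ (attach-bounds n i m)) (attach-≤ n i r) (attach-≤ n i m) (n≤2n∸1 1≤n) ⟩
  + (n ∸ (a ⊔ b)) ∎
  where
  N = 2 * n ∸ 1
  a = attach n i r
  b = attach n i m
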